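{- For every integer $m\ge 0$, the string $1\underbrace{0\cdots0}_{m}10$ (a $1$, then $m$ zeros, then $1$, then $0$) is a code with $m+3$ digits.
   Context: Code: let $x=a_na_{n-1}\dots a_1a_0$ be a positive integer with $n+1\ge 2$ decimal digits and $a_n>a_0$. Its code is the string $z_0z_1\dots z_n$ of $0$s and $1$s defined by setting $z_{ -1}=0$, and for $i=0,\dots,n-1$: $z_i=1$ if $a_i-a_{n-i}-z_{i-1}<0$ and $z_i=0$ otherwise; and $z_n=0$. (Thus $z_i$ records whether a borrow from position $i+1$ occurs at position $i$ in the column subtraction of the reverse $x'=a_0a_1\dots a_n$ from $x$; in particular $z_0=1$.) A finite string of $0$s and $1$s is called a code if it is the code of some such integer $x$. -}

module Defs where

open import Data.Nat using (ℕ; zero; suc; _+_; _∸_; _<_; _<ᵇ_; _≤_; _<?_)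
open import Relation.Nullary using (yes; no)
open import Data.Bool using (Bool; true; false; if_then_else_)
open import Data.Fin using (Fin; toℕ)
open import Data.Vec using (Vec; lookup)
open import Data.List using (List; []; _∷_; replicate; _++_)
open import Data.Product using (Σ; _×_)
open import Relation.Binary.PropositionalEquality using (_≡_)

-- A decimal number with n+1 digits, given by its digits a_0 … a_n,
-- where a_i is the digit at position i (a_0 the units digit).
Digits : ℕ → Set
Digits n = Vec (Fin 10) (suc n)

digit : {n : ℕ} → Digits n → ℕ → ℕ
digit {n} a i = go i
  where
  go : ℕ → ℕ
  go i with i <? suc n
  ... | yes p = toℕ (lookup a (Data.Fin.fromℕ< p))
  ... | no _ = 0

b2n : Bool → ℕ
b2n true = 1
b2n false = 0

-- codeFrom a i k zprev : the string z_i z_{i+1} … z_{n-1} z_n where k = n - i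
-- remaining steps, zprev = z_{i-1}.
-- z_i = 1 iff a_i - a_{n-i} - z_{i-1} < 0, i.e. a_i < a_{n-i} + z_{i-1}.
codeFrom : {n : ℕ} → Digits n → (i k : ℕ) → ℕ → List ℕ
codeFrom a i zero zprev = 0 ∷ []
codeFrom {n} a i (suc k) zprev =
  let z = b2n (digit a i <ᵇ (digit a (n ∸ i) + zprev))
  in z ∷ codeFrom a (suc i) k z

code : {n : ℕ} → Digits n → List ℕ
code {n} a = codeFrom a 0 n 0

IsCode : List ℕ → Set
IsCode s = Σ ℕ λ n → Σ (Digits n) λ a →
  (1 ≤ n) × (digit a 0 < digit a n) × (code a ≡ s)

-- The witness is x = 10^(m+2) + 10, whose digit string is the claimed code itself.
-- Subtracting its reverse 10^(m+1) + 1, the units column borrows (0 < 1); column 1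
-- pays that borrow with its digit 1; then every column compares 0 with 0 except
-- column m+1, which meets the digit 1 of position 1 and borrows. For m = 0 the
-- columns 1 and m+1 coincide, and 1 < 1 + 1 borrows there.
module Submission where

open import Defs
open import Data.Nat using (ℕ; zero; suc; _+_; _∸_; _<_; _<ᵇ_; _<?_; s≤s; z≤n)
open import Data.Nat.Properties using (+-suc; m+n∸m≡n; m≤n+m; <⇒≤; m<m+n; ≤-refl; ≤-pred; <-irrelevant)
open import Data.Fin using (Fin; toℕ; fromℕ<)
open import Data.Fin.Patterns using (0F; 1F)
open import Data.Vec using ([]; _∷_; lookup)
open import Data.List using (replicate; _++_; length) renaming ([] to []ₗ; _∷_ to _∷ₗ_)
open import Data.Product using (_×_; _,_)
open import Data.Empty using (⊥-elim)
open import Function using (_∘_)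
open import Relation.Nullary using (¬_; Dec; yes; no)
open import Relation.Binary.PropositionalEquality
  using (_≡_; refl; sym; trans; cong; module ≡-Reasoning)

module _ {n : ℕ} (a : Digits n) where

  digit-lookup : ∀ i (i<n+1 : i < suc n) → digit a i ≡ toℕ (lookup a (fromℕ< i<n+1))
  digit-lookup i i<n+1 with i <? suc n
  ... | yes i<n+1′ rewrite <-irrelevant i<n+1′ i<n+1 = refl
  ... | no i≮n+1 = ⊥-elim (i≮n+1 i<n+1)

  digit-outOfRange : ∀ i → ¬ i < suc n → digit a i ≡ 0
  digit-outOfRange i i≮n+1 with i <? suc n
  ... | yes i<n+1 = ⊥-elim (i≮n+1 i<n+1)
  ... | no _ = refl

digit-∷-suc : ∀ {n} (d : Fin 10) (a : Digits n) i → digit (d ∷ a) (suc i) ≡ digit a i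
digit-∷-suc {n} d a i = byRange (i <? suc n)
  where
  byRange : Dec (i < suc n) → digit (d ∷ a) (suc i) ≡ digit a i
  byRange (yes i<n+1) =
    trans (digit-lookup (d ∷ a) (suc i) (s≤s i<n+1)) (sym (digit-lookup a i i<n+1))
  byRange (no i≮n+1) =
    trans (digit-outOfRange (d ∷ a) (suc i) (i≮n+1 ∘ ≤-pred)) (sym (digit-outOfRange a i i≮n+1))

m+1+n≡o⇒m<o : ∀ {m n o} → m + suc n ≡ o → m < o
m+1+n≡o⇒m<o {m} refl = m<m+n m (s≤s z≤n)

m+1+n≡o⇒n<o : ∀ {m n o} → m + suc n ≡ o → n < o
m+1+n≡o⇒n<o {m} {n} refl rewrite +-suc m n = s≤s (m≤n+m n m)

m+n≡o⇒o∸m≡n : ∀ {m n o} → m + n ≡ o → o ∸ m ≡ n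
m+n≡o⇒o∸m≡n {m} {n} refl = m+n∸m≡n m n

borrow : ℕ → ℕ → ℕ → ℕ
borrow x y z = b2n (x <ᵇ y + z)

codeFrom-suc : ∀ {n} (a : Digits n) i k z {x y} →
  digit a i ≡ x → digit a (n ∸ i) ≡ y →
  codeFrom a i (suc k) z ≡ borrow x y z ∷ₗ codeFrom a (suc i) k (borrow x y z)
codeFrom-suc a i k z refl refl = refl

tenPow : (m : ℕ) → Digits m
tenPow zero = 1F ∷ []
tenPow (suc m) = 0F ∷ tenPow m

digit-tenPow-< : ∀ m j → j < m → digit (tenPow m) j ≡ 0
digit-tenPow-< (suc m) zero _ = refl
digit-tenPow-< (suc m) (suc j) (s≤s j<m) =
  trans (digit-∷-suc 0F (tenPow m) j) (digit-tenPow-< m j j<m)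

digit-tenPow-≡ : ∀ m → digit (tenPow m) m ≡ 1
digit-tenPow-≡ zero = refl
digit-tenPow-≡ (suc m) = trans (digit-∷-suc 0F (tenPow m) m) (digit-tenPow-≡ m)

witness : (m : ℕ) → Digits (2 + m)
witness m = 0F ∷ 1F ∷ tenPow m

module _ (m : ℕ) where

  digit-witness-0 : digit (witness m) 0 ≡ 0
  digit-witness-0 = refl

  digit-witness-1 : digit (witness m) 1 ≡ 1
  digit-witness-1 = digit-∷-suc 0F (1F ∷ tenPow m) 0

  digit-witness-middle : ∀ j → j < m → digit (witness m) (2 + j) ≡ 0
  digit-witness-middle j j<m = begin
    digit (witness m) (2 + j)  ≡⟨ digit-∷-suc 0F (1F ∷ tenPow m) (suc j) ⟩
    digit (1F ∷ tenPow m) (suc j)  ≡⟨ digit-∷-suc 1F (tenPow m) j ⟩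
    digit (tenPow m) j  ≡⟨ digit-tenPow-< m j j<m ⟩
    0  ∎
    where open ≡-Reasoning

  digit-witness-top : digit (witness m) (2 + m) ≡ 1
  digit-witness-top = trans (digit-∷-suc 0F (1F ∷ tenPow m) (suc m))
    (trans (digit-∷-suc 1F (tenPow m) m) (digit-tenPow-≡ m))

  codeFrom-witness-tail : ∀ j r → j + suc r ≡ m →
    codeFrom (witness m) (2 + j) (suc r) 0 ≡ replicate r 0 ++ 1 ∷ₗ 0 ∷ₗ []ₗ
  codeFrom-witness-tail j zero j+1≡m =
    codeFrom-suc (witness m) (2 + j) 0 0 (digit-witness-middle j (m+1+n≡o⇒m<o j+1≡m))
      (trans (cong (digit (witness m)) (m+n≡o⇒o∸m≡n {j} j+1≡m)) digit-witness-1)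
  codeFrom-witness-tail j (suc r) j+r+2≡m = begin
    codeFrom (witness m) (2 + j) (2 + r) 0
      ≡⟨ codeFrom-suc (witness m) (2 + j) (suc r) 0 (digit-witness-middle j (m+1+n≡o⇒m<o j+r+2≡m))
           (trans (cong (digit (witness m)) (m+n≡o⇒o∸m≡n {j} j+r+2≡m))
                  (digit-witness-middle r (<⇒≤ (m+1+n≡o⇒n<o j+r+2≡m)))) ⟩
    0 ∷ₗ codeFrom (witness m) (3 + j) (suc r) 0
      ≡⟨ cong (0 ∷ₗ_) (codeFrom-witness-tail (suc j) r (trans (sym (+-suc j (suc r))) j+r+2≡m)) ⟩
    0 ∷ₗ replicate r 0 ++ 1 ∷ₗ 0 ∷ₗ []ₗ  ∎
    where open ≡-Reasoning

codeFrom-witness-1 : ∀ m → codeFrom (witness m) 1 (suc m) 1 ≡ replicate m 0 ++ 1 ∷ₗ 0 ∷ₗ []ₗ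
codeFrom-witness-1 zero = codeFrom-suc (witness 0) 1 0 1 (digit-witness-1 0) (digit-witness-1 0)
codeFrom-witness-1 (suc k) = begin
  codeFrom (witness (suc k)) 1 (2 + k) 1
    ≡⟨ codeFrom-suc (witness (suc k)) 1 (suc k) 1
         (digit-witness-1 (suc k)) (digit-witness-middle (suc k) k ≤-refl) ⟩
  0 ∷ₗ codeFrom (witness (suc k)) 2 (suc k) 0
    ≡⟨ cong (0 ∷ₗ_) (codeFrom-witness-tail (suc k) 0 k refl) ⟩
  0 ∷ₗ replicate k 0 ++ 1 ∷ₗ 0 ∷ₗ []ₗ  ∎
  where open ≡-Reasoning

code-witness : ∀ m → code (witness m) ≡ 1 ∷ₗ replicate m 0 ++ 1 ∷ₗ 0 ∷ₗ []ₗ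
code-witness m = begin
  codeFrom (witness m) 0 (2 + m) 0
    ≡⟨ codeFrom-suc (witness m) 0 (suc m) 0 (digit-witness-0 m) (digit-witness-top m) ⟩
  1 ∷ₗ codeFrom (witness m) 1 (suc m) 1
    ≡⟨ cong (1 ∷ₗ_) (codeFrom-witness-1 m) ⟩
  1 ∷ₗ replicate m 0 ++ 1 ∷ₗ 0 ∷ₗ []ₗ  ∎
  where open ≡-Reasoning

length-1-0ᵐ-1-0 : ∀ m → length (1 ∷ₗ replicate m 0 ++ 1 ∷ₗ 0 ∷ₗ []ₗ) ≡ m + 3
length-1-0ᵐ-1-0 zero = refl
length-1-0ᵐ-1-0 (suc m) = cong suc (length-1-0ᵐ-1-0 m)

proposition6 : (m : ℕ) →
    IsCode (1 ∷ₗ replicate m 0 ++ 1 ∷ₗ 0 ∷ₗ []ₗ) × (length (1 ∷ₗ replicate m 0 ++ 1 ∷ₗ 0 ∷ₗ []ₗ) ≡ m + 3)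
proposition6 m =
  (2 + m , witness m , s≤s z≤n , leading>units , code-witness m) , length-1-0ᵐ-1-0 m
  where
  leading>units : digit (witness m) 0 < digit (witness m) (2 + m)
  leading>units rewrite digit-witness-top m = s≤s z≤n
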